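{- Let $G$ be a connected graph of order $n\geq 5$, and let \[ F(n)=\begin{cases}\binom{n-2}{2}+2, & \text{if } n\geq 5 \text{ and } n\notin\{6,8\};\\ 9, & \text{if } n=6;\\ 18, & \text{if } n=8.\end{cases} \] If $|E(G)|>F(n)$, then $G$ has a $\{P_{2},C_{3},P_{5},\mathcal{T}(3)\}$-factor.
   Context: All graphs are finite, simple and undirected. $P_k$ is the path on $k$ vertices and $C_3$ the triangle. For a set $\mathcal{H}$ of connected graphs, an $\mathcal{H}$-factor of $G$ is a spanning subgraph of $G$ each of whose connected components is isomorphic to a member of $\mathcal{H}$. A $\{1,3\}$-tree is a tree in which every vertex has degree $1$ or $3$. For a $\{1,3\}$-tree $R$, let $T_R$ be the tree obtained from $R$ by inserting a new vertex of degree $2$ into every edge of $R$ and attaching a new pendant edge to every leaf of $R$. $\mathcal{T}(3)$ denotes any tree of the form $T_R$ for some $\{1,3\}$-tree $R$; thus a $\{P_{2},C_{3},P_{5},\mathcal{T}(3)\}$-factor is a spanning subgraph each of whose components is isomorphic to $P_2$, $C_3$, $P_5$, or some such $T_R$. -}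

module Defs where

open import Data.Nat using (ℕ; zero; suc; _+_; _∸_; _<_; _≤_)
open import Data.Nat.Combinatorics using (_C_)
open import Data.Bool using (Bool; true; false; _∧_; if_then_else_)
open import Data.Fin using (Fin; toℕ; inject₁; fromℕ) renaming (zero to fzero; suc to fsuc)
import Data.Fin as F
open import Data.Fin.Properties using (_<?_)
open import Data.List using (List; []; _∷_; map; allFin)
open import Data.Nat.ListAction using (sum)
open import Data.Product using (Σ; _×_; proj₁; proj₂)
open import Data.Sum using (_⊎_)
open import Relation.Binary.PropositionalEquality using (_≡_; _≢_)
open import Relation.Nullary.Decidable using (⌊_⌋)
open import Function.Definitions using (Injective; Bijective)

record Graph (n : ℕ) : Set where
  field
    adj   : Fin n → Fin n → Bool
    sym   : ∀ u v → adj u v ≡ adj v u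
    irrefl : ∀ v → adj v v ≡ false
open Graph public

count : List Bool → ℕ
count [] = 0
count (true ∷ bs) = suc (count bs)
count (false ∷ bs) = count bs

edgeCount : ∀ {n} → Graph n → ℕ
edgeCount {n} G =
  sum (map (λ i → count (map (λ j → ⌊ i <? j ⌋ ∧ adj G i j) (allFin n))) (allFin n))

degree : ∀ {n} → Graph n → Fin n → ℕ
degree {n} G v = count (map (adj G v) (allFin n))

data Reach {n} (G : Graph n) : Fin n → Fin n → Set where
  here : ∀ {v} → Reach G v v
  step : ∀ {u w v} → adj G u w ≡ true → Reach G w v → Reach G u v

Connected : ∀ {n} → Graph n → Set
Connected G = ∀ u v → Reach G u v

HasCycle : ∀ {n} → Graph n → Set
HasCycle {n} G = Σ ℕ λ k → Σ (Fin (3 + k) → Fin n) λ c →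
  Injective _≡_ _≡_ c
  × (∀ (i : Fin (2 + k)) → adj G (c (inject₁ i)) (c (fsuc i)) ≡ true)
  × adj G (c (fromℕ (2 + k))) (c fzero) ≡ true

IsTree : ∀ {n} → Graph n → Set
IsTree G = Connected G × (HasCycle G → Data.Empty.⊥)
  where import Data.Empty

IsOneThreeTree : ∀ {n} → Graph n → Set
IsOneThreeTree G = IsTree G × (∀ v → degree G v ≡ 1 ⊎ degree G v ≡ 3)

-- Vertices of T_R: original vertices, one subdivision vertex per edge uv (u<v), one pendant vertex per leaf.
data TV {r} (R : Graph r) : Set where
  orig : Fin r → TV R
  mid  : (u v : Fin r) → u F.< v → adj R u v ≡ true → TV R
  pend : (v : Fin r) → degree R v ≡ 1 → TV R

data TAdj {r} (R : Graph r) : TV R → TV R → Set where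
  o-m : ∀ u v p q → TAdj R (orig u) (mid u v p q)
  m-o : ∀ u v p q → TAdj R (mid u v p q) (orig u)
  o-m′ : ∀ u v p q → TAdj R (orig v) (mid u v p q)
  m-o′ : ∀ u v p q → TAdj R (mid u v p q) (orig v)
  o-p : ∀ v p → TAdj R (orig v) (pend v p)
  p-o : ∀ v p → TAdj R (pend v p) (orig v)

PathAdj : ∀ {k} → Fin k → Fin k → Set
PathAdj i j = suc (toℕ i) ≡ toℕ j ⊎ suc (toℕ j) ≡ toℕ i

data Shape : Set where
  p2 c3 p5 : Shape
  tR : (r : ℕ) (R : Graph r) → IsOneThreeTree R → Shape

Vertex : Shape → Set
Vertex p2 = Fin 2
Vertex c3 = Fin 3
Vertex p5 = Fin 5
Vertex (tR r R _) = TV R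

SAdj : (s : Shape) → Vertex s → Vertex s → Set
SAdj p2 i j = PathAdj i j
SAdj c3 i j = i ≢ j
SAdj p5 i j = PathAdj i j
SAdj (tR r R _) x y = TAdj R x y

-- A {P2, C3, P5, T(3)}-factor: vertex-disjoint copies of allowed shapes (as subgraphs of G)
-- covering every vertex exactly once; their union is the spanning subgraph whose components they are.
record Factor {n} (G : Graph n) : Set where
  field
    m     : ℕ
    shape : Fin m → Shape
    emb   : (j : Fin m) → Vertex (shape j) → Fin n
    cover : Bijective _≡_ _≡_ (λ (p : Σ (Fin m) (λ j → Vertex (shape j))) → emb (proj₁ p) (proj₂ p))
    edges : ∀ j x y → SAdj (shape j) x y → adj G (emb j x) (emb j y) ≡ true

F : ℕ → ℕ
F 6 = 9
F 8 = 18
F n = ((n ∸ 2) C 2) + 2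

-- Induction on n ≥ 4 with the invariant Admissible (codegBound n): no isolated vertex, and
-- codegree sum Σₓ (n − deg x) = n² − 2|E| at most codegBound n = n² − 2 (F n + 1).
-- Let u have minimum degree and v minimum degree among the neighbours of u, with codegrees
-- p and q. Deleting u and v lowers the codegree sum by exactly 2p + 2q − 2; as that sum is at
-- most deg u · q + p², the bound survives (checked exhaustively for n ≤ 8), and an isolated
-- vertex of G − u − v would force 2p + 2q ≥ 2n + 4, too much for G. A factor of G − u − v
-- together with the P₂ on uv is a factor of G. On 4 and 5 vertices a factor into P₂'s, or
-- into P₅ or C₃ + P₂, is found by exhaustive search.

module Submission where

open import Data.Bool using (Bool; true; false; not; _∧_; T; if_then_else_)
open import Data.Bool.Properties using (T-∧) renaming (_≟_ to _≟ᵇ_)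
open import Data.Empty using (⊥; ⊥-elim)
open import Data.Fin using (Fin; zero; suc; toℕ; punchIn; punchOut)
import Data.Fin.Properties as Finₚ
open import Data.Fin.Permutation using (Permutation′; insert)
open import Data.List using (List; []; _∷_; map; allFin; tabulate; concatMap; cartesianProduct)
open import Data.List.Properties using (map-tabulate)
open import Data.List.Relation.Unary.Any using (Any; any?; satisfied)
open import Data.Nat using (ℕ; zero; suc; _+_; _*_; _∸_; _≤_; _<_; z≤n; s≤s; s≤s⁻¹; _≟_; _≤?_)
open import Data.Nat.Combinatorics using (_C_; nC1≡n; nCk+nC[k+1]≡[n+1]C[k+1])
import Data.Nat.ListAction as List
open import Data.Nat.Properties
open import Algebra.Properties.CommutativeMonoid.Sum +-0-commutativeMonoid
  using (sum; sum-remove; ∑-distrib-+; sum-cong-≗)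
open import Data.Nat.Tactic.RingSolver using (solve-∀)
open import Data.Product using (Σ; ∃; _×_; _,_; proj₁; proj₂)
open import Data.Sum using (_⊎_; inj₁; inj₂; [_,_])
open import Data.Sum.Function.Propositional using (_⊎-↔_)
open import Data.Vec as Vec using (Vec; lookup)
open import Data.Vec.Functional using (Vector) renaming (_∷_ to _◂_)
open import Data.Vec.Properties using (lookup∘tabulate)
open import Function using (_∘_; id; _↔_; _⇔_; Inverse; mk↔ₛ′; mk⤖; mk⇔; Equivalence; Bijection)
open import Function.Construct.Composition using (_↔-∘_)
open import Function.Construct.Identity using (↔-id)
open import Function.Properties.Bijection using (⤖⇒↔)
open import Function.Properties.Inverse using (↔-sym; ↔⇒⤖)
open import Relation.Binary.PropositionalEquality
  using (_≡_; _≢_; _≗_; refl; sym; trans; cong; cong₂; subst; subst₂; module ≡-Reasoning)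
open import Relation.Nullary using (yes; no; Dec; ¬?; _⊎-dec_; _×-dec_; _→-dec_; contradiction)
open import Relation.Nullary.Decidable using (⌊_⌋; isYes; isYes≗does; does-⇔; toWitness)

open import Defs renaming (sym to adj-sym)

bit : Bool → ℕ
bit true  = 1
bit false = 0

bit≤1 : ∀ b → bit b ≤ 1
bit≤1 true  = ≤-refl
bit≤1 false = z≤n

countTrue : ∀ {n} → Vector Bool n → ℕ
countTrue f = sum (bit ∘ f)

sum-mono-≤ : ∀ {n} {f g : Vector ℕ n} → (∀ i → f i ≤ g i) → sum f ≤ sum g
sum-mono-≤ {zero}  f≤g = z≤n
sum-mono-≤ {suc n} f≤g = +-mono-≤ (f≤g zero) (sum-mono-≤ (f≤g ∘ suc))

sum-const : ∀ n c → sum {n} (λ _ → c) ≡ n * c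
sum-const zero    c = refl
sum-const (suc n) c = cong (c +_) (sum-const n c)

sum-*ʳ : ∀ {n} (f : Vector ℕ n) c → sum (λ i → f i * c) ≡ sum f * c
sum-*ʳ {zero}  f c = refl
sum-*ʳ {suc n} f c = trans (cong (f zero * c +_) (sum-*ʳ (f ∘ suc) c)) (sym (*-distribʳ-+ c (f zero) _))

List-sum-map-allFin : ∀ {n} (f : Vector ℕ n) → List.sum (map f (allFin n)) ≡ sum f
List-sum-map-allFin {n} f = trans (cong List.sum (map-tabulate id f)) (go f)
  where
  go : ∀ {n} (f : Vector ℕ n) → List.sum (tabulate f) ≡ sum f
  go {zero}  f = refl
  go {suc n} f = cong (f zero +_) (go (f ∘ suc))

count-map-allFin : ∀ {n} (f : Vector Bool n) → count (map f (allFin n)) ≡ countTrue f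
count-map-allFin {n} f = trans (cong count (map-tabulate id f)) (go f)
  where
  go : ∀ {n} (f : Vector Bool n) → count (tabulate f) ≡ countTrue f
  go {zero}  f = refl
  go {suc n} f with f zero
  ... | true  = cong suc (go (f ∘ suc))
  ... | false = go (f ∘ suc)

countTrue-pos : ∀ {n} (f : Vector Bool n) {i} → f i ≡ true → 1 ≤ countTrue f
countTrue-pos {suc n} f {i} fi≡true rewrite sum-remove {i = i} (bit ∘ f) | fi≡true = s≤s z≤n

countTrue-zero : ∀ {n} (f : Vector Bool n) → countTrue f ≡ 0 → ∀ i → f i ≡ false
countTrue-zero f count≡0 i with f i in fi
... | false = refl
... | true  = contradiction (subst (1 ≤_) count≡0 (countTrue-pos f fi)) λ ()

countTrue-witness : ∀ {n} (f : Vector Bool n) → 1 ≤ countTrue f → ∃ λ i → f i ≡ true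
countTrue-witness {suc n} f pos with f zero in f0
... | true  = zero , f0
... | false = let i , fi = countTrue-witness (f ∘ suc) pos in suc i , fi

countTrue+countTrue-not : ∀ {n} (f : Vector Bool n) → countTrue f + countTrue (not ∘ f) ≡ n
countTrue+countTrue-not {n} f = begin
  countTrue f + countTrue (not ∘ f)         ≡⟨ ∑-distrib-+ (bit ∘ f) (bit ∘ not ∘ f) ⟨
  sum (λ i → bit (f i) + bit (not (f i)))   ≡⟨ sum-cong-≗ (bit+bit-not ∘ f) ⟩
  sum {n} (λ _ → 1)                         ≡⟨ sum-const n 1 ⟩
  n * 1                                     ≡⟨ *-identityʳ n ⟩
  n                                         ∎
  where
  open ≡-Reasoning
  bit+bit-not : ∀ b → bit b + bit (not b) ≡ 1
  bit+bit-not true  = refl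
  bit+bit-not false = refl

-- Degrees, codegrees and vertex deletion

rowSum : ∀ {n} → (Bool → ℕ) → Graph n → Fin n → ℕ
rowSum h G x = sum (h ∘ adj G x)

totalSum : ∀ {n} → (Bool → ℕ) → Graph n → ℕ
totalSum h G = sum (rowSum h G)

-- codeg G x counts x itself, as adj is irreflexive.
deg codeg : ∀ {n} → Graph n → Fin n → ℕ
deg   = rowSum bit
codeg = rowSum (bit ∘ not)

degSum codegSum : ∀ {n} → Graph n → ℕ
degSum   = totalSum bit
codegSum = totalSum (bit ∘ not)

_≈_ : ∀ {n} → Graph n → Graph n → Set
G ≈ H = ∀ x y → adj G x y ≡ adj H x y

rowSum-cong : ∀ {n} h {G H : Graph n} → G ≈ H → rowSum h G ≗ rowSum h H
rowSum-cong {n} h G≈H x = sum-cong-≗ {n} (cong h ∘ G≈H x)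

totalSum-cong : ∀ {n} h {G H : Graph n} → G ≈ H → totalSum h G ≡ totalSum h H
totalSum-cong {n} h {G} {H} G≈H = sum-cong-≗ {n} (rowSum-cong h {G} {H} G≈H)

deg+codeg : ∀ {n} (G : Graph n) x → deg G x + codeg G x ≡ n
deg+codeg G x = countTrue+countTrue-not (adj G x)

order≤deg+codeg : ∀ {m} (G : Graph m) x {d} → deg G x ≤ d → m ≤ d + codeg G x
order≤deg+codeg G x {d} deg≤d = subst (_≤ d + codeg G x) (deg+codeg G x) (+-monoˡ-≤ (codeg G x) deg≤d)

codeg-pos : ∀ {n} (G : Graph n) x → 1 ≤ codeg G x
codeg-pos G x = countTrue-pos (not ∘ adj G x) (cong not (irrefl G x))

codegSum+degSum : ∀ {n} (G : Graph n) → codegSum G + degSum G ≡ n * n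
codegSum+degSum {n} G = begin
  codegSum G + degSum G             ≡⟨ ∑-distrib-+ (codeg G) (deg G) ⟨
  sum (λ x → codeg G x + deg G x)   ≡⟨ sum-cong-≗ (λ x → trans (+-comm (codeg G x) _) (deg+codeg G x)) ⟩
  sum {n} (λ _ → n)                 ≡⟨ sum-const n n ⟩
  n * n                             ∎
  where open ≡-Reasoning

infixl 5 _∖_

_∖_ : ∀ {n} → Graph (suc n) → Fin (suc n) → Graph n
G ∖ u = record
  { adj    = λ x y → adj G (punchIn u x) (punchIn u y)
  ; sym    = λ x y → adj-sym G (punchIn u x) (punchIn u y)
  ; irrefl = λ x → irrefl G (punchIn u x)
  }

rowSum-∖ : ∀ {n} h (G : Graph (suc n)) u x →
           rowSum h G (punchIn u x) ≡ h (adj G u (punchIn u x)) + rowSum h (G ∖ u) x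
rowSum-∖ h G u x = trans (sum-remove {i = u} (h ∘ adj G (punchIn u x)))
                         (cong (λ b → h b + rowSum h (G ∖ u) x) (adj-sym G (punchIn u x) u))

rowSum-removed : ∀ {n} h (G : Graph (suc n)) u →
                 rowSum h G u ≡ h false + sum (λ x → h (adj G u (punchIn u x)))
rowSum-removed h G u = trans (sum-remove {i = u} (h ∘ adj G u))
                             (cong (λ b → h b + sum (λ x → h (adj G u (punchIn u x)))) (irrefl G u))

totalSum-∖ : ∀ {n} h (G : Graph (suc n)) u →
             totalSum h G + h false ≡ rowSum h G u + rowSum h G u + totalSum h (G ∖ u)
totalSum-∖ h G u = begin
  totalSum h G + h false                                     ≡⟨ cong (_+ h false) (sum-remove {i = u} (rowSum h G)) ⟩
  r + sum (rowSum h G ∘ punchIn u) + h false                 ≡⟨ cong (λ s → r + s + h false) rest ⟩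
  r + (c + totalSum h (G ∖ u)) + h false                     ≡⟨ shuffle r c (totalSum h (G ∖ u)) (h false) ⟩
  r + (h false + c) + totalSum h (G ∖ u)                     ≡⟨ cong (λ s → r + s + totalSum h (G ∖ u)) (rowSum-removed h G u) ⟨
  r + r + totalSum h (G ∖ u)                                 ∎
  where
  open ≡-Reasoning
  r = rowSum h G u
  c = sum (λ x → h (adj G u (punchIn u x)))
  rest : sum (rowSum h G ∘ punchIn u) ≡ c + totalSum h (G ∖ u)
  rest = trans (sum-cong-≗ (rowSum-∖ h G u)) (∑-distrib-+ (λ x → h (adj G u (punchIn u x))) (rowSum h (G ∖ u)))
  shuffle : ∀ r c t f → r + (c + t) + f ≡ r + (f + c) + t
  shuffle = solve-∀

degSum-∖ : ∀ {n} (G : Graph (suc n)) u → degSum G ≡ deg G u + deg G u + degSum (G ∖ u)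
degSum-∖ G u = trans (sym (+-identityʳ (degSum G))) (totalSum-∖ bit G u)

codegSum-∖ : ∀ {n} (G : Graph (suc n)) u → codegSum G + 1 ≡ codeg G u + codeg G u + codegSum (G ∖ u)
codegSum-∖ = totalSum-∖ (bit ∘ not)

⌊⌋-⇔ : ∀ {A B : Set} → A ⇔ B → (a? : Dec A) (b? : Dec B) → ⌊ a? ⌋ ≡ ⌊ b? ⌋
⌊⌋-⇔ A⇔B a? b? = trans (isYes≗does a?) (trans (does-⇔ A⇔B a? b?) (sym (isYes≗does b?)))

upperDeg : ∀ {n} → Graph n → Fin n → ℕ
upperDeg G i = countTrue (λ j → ⌊ i Finₚ.<? j ⌋ ∧ adj G i j)

edgeCount≡sum-upperDeg : ∀ {n} (G : Graph n) → edgeCount G ≡ sum (upperDeg G)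
edgeCount≡sum-upperDeg {n} G =
  trans (List-sum-map-allFin row) (sum-cong-≗ {n} λ i → count-map-allFin (λ j → ⌊ i Finₚ.<? j ⌋ ∧ adj G i j))
  where
  row : Fin n → ℕ
  row i = count (map (λ j → ⌊ i Finₚ.<? j ⌋ ∧ adj G i j) (allFin n))

sum-upperDeg-∖ : ∀ {n} (G : Graph (suc n)) → sum (upperDeg G) ≡ deg G zero + sum (upperDeg (G ∖ zero))
sum-upperDeg-∖ {n} G = cong₂ _+_ upperDeg-zero (sum-cong-≗ {n} upperDeg-suc)
  where
  upperDeg-zero : upperDeg G zero ≡ deg G zero
  upperDeg-zero = cong (λ b → bit b + sum (bit ∘ adj G zero ∘ suc)) (sym (irrefl G zero))
  upperDeg-suc : ∀ i → upperDeg G (suc i) ≡ upperDeg (G ∖ zero) i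
  upperDeg-suc i = cong₂ _+_
    (cong (λ b → bit (b ∧ adj G (suc i) zero)) (⌊⌋-⇔ (mk⇔ (λ ()) λ ()) (suc i Finₚ.<? zero {n}) (no id)))
    (sum-cong-≗ {n} λ j →
      cong (λ b → bit (b ∧ adj G (suc i) (suc j))) (⌊⌋-⇔ (mk⇔ s≤s⁻¹ s≤s) (suc i Finₚ.<? suc j) (i Finₚ.<? j)))

handshake : ∀ {n} (G : Graph n) → edgeCount G + edgeCount G ≡ degSum G
handshake G = trans (cong (λ e → e + e) (edgeCount≡sum-upperDeg G)) (go G)
  where
  go : ∀ {n} (G : Graph n) → sum (upperDeg G) + sum (upperDeg G) ≡ degSum G
  go {zero}  G = refl
  go {suc n} G = begin
    sum (upperDeg G) + sum (upperDeg G)   ≡⟨ cong (λ s → s + s) (sum-upperDeg-∖ G) ⟩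
    (d + s) + (d + s)                     ≡⟨ swap d s ⟩
    d + d + (s + s)                       ≡⟨ cong (d + d +_) (go (G ∖ zero)) ⟩
    d + d + degSum (G ∖ zero)             ≡⟨ degSum-∖ G zero ⟨
    degSum G                              ∎
    where
    open ≡-Reasoning
    d = deg G zero
    s = sum (upperDeg (G ∖ zero))
    swap : ∀ a b → a + b + (a + b) ≡ a + a + (b + b)
    swap = solve-∀

codegSum-isolated : ∀ {m} (H : Graph m) z → deg H z ≡ 0 → 3 * m ≤ codegSum H + 2
codegSum-isolated {suc m} H z deg≡0 = begin
  3 * suc m                                      ≡⟨ split m ⟩
  suc m + m * 2 + 2                              ≤⟨ +-monoˡ-≤ 2 (+-mono-≤ (≤-reflexive codeg-z) others) ⟩
  codeg H z + sum (codeg H ∘ punchIn z) + 2      ≡⟨ cong (_+ 2) (sum-remove {i = z} (codeg H)) ⟨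
  codegSum H + 2                                 ∎
  where
  open ≤-Reasoning
  split : ∀ m → 3 * suc m ≡ suc m + m * 2 + 2
  split = solve-∀
  codeg-z : suc m ≡ codeg H z
  codeg-z = trans (sym (deg+codeg H z)) (cong (_+ codeg H z) deg≡0)
  codeg≥2 : ∀ x → 2 ≤ codeg H (punchIn z x)
  codeg≥2 x = begin
    2                                                       ≤⟨ s≤s (codeg-pos (H ∖ z) x) ⟩
    bit (not false) + codeg (H ∖ z) x                       ≡⟨ cong (λ b → bit (not b) + codeg (H ∖ z) x) (countTrue-zero (adj H z) deg≡0 (punchIn z x)) ⟨
    bit (not (adj H z (punchIn z x))) + codeg (H ∖ z) x     ≡⟨ rowSum-∖ (bit ∘ not) H z x ⟨
    codeg H (punchIn z x)                                   ∎
  others : m * 2 ≤ sum (codeg H ∘ punchIn z)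
  others = subst (_≤ sum (codeg H ∘ punchIn z)) (sum-const m 2) (sum-mono-≤ codeg≥2)

MinDegree≥1 : ∀ {n} → Graph n → Set
MinDegree≥1 G = ∀ x → 1 ≤ deg G x

neighbour-of-reachable : ∀ {n} {G : Graph n} {x y} → Reach G x y → x ≢ y → ∃ λ z → adj G x z ≡ true
neighbour-of-reachable here         x≢x = contradiction refl x≢x
neighbour-of-reachable (step x~z _) _   = _ , x~z

minDegree≥1-of-connected : ∀ {n} (G : Graph (2 + n)) → Connected G → MinDegree≥1 G
minDegree≥1-of-connected G connected x =
  countTrue-pos (adj G x) (proj₂ (neighbour-of-reachable (connected x (other x)) (x≢other x)))
  where
  other : ∀ {n} → Fin (2 + n) → Fin (2 + n)
  other zero    = suc zero
  other (suc _) = zero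
  x≢other : ∀ {n} (x : Fin (2 + n)) → x ≢ other x
  x≢other zero    ()
  x≢other (suc _) ()

Admissible : ∀ {n} → ℕ → Graph n → Set
Admissible b G = MinDegree≥1 G × codegSum G ≤ b

admissible-cong : ∀ {n b} {G H : Graph n} → G ≈ H → Admissible b G → Admissible b H
admissible-cong {b = b} {G} {H} G≈H (δ≥1 , σ≤b) =
  (λ x → subst (1 ≤_) (rowSum-cong bit {G} {H} G≈H x) (δ≥1 x)) ,
  subst (_≤ b) (totalSum-cong (bit ∘ not) {G} {H} G≈H) σ≤b

Component : ∀ {m} → (Fin m → Shape) → Set
Component {m} shape = Σ (Fin m) (Vertex ∘ shape)

factor : ∀ {m n} {G : Graph n} (shape : Fin m → Shape) (e : Component shape ↔ Fin n) →
         (∀ j x y → SAdj (shape j) x y → adj G (Inverse.to e (j , x)) (Inverse.to e (j , y)) ≡ true) →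
         Factor G
factor shape e edges = record
  { shape = shape ; emb = λ j x → Inverse.to e (j , x) ; cover = Bijection.bijective (↔⇒⤖ e) ; edges = edges }

placement : ∀ {n} {G : Graph n} (F : Factor G) → Component (Factor.shape F) ↔ Fin n
placement F = ⤖⇒↔ (mk⤖ (Factor.cover F))

factor-cong : ∀ {n} {G H : Graph n} → G ≈ H → Factor H → Factor G
factor-cong G≈H F = factor shape (placement F) λ j x y xy → trans (G≈H _ _) (edges j x y xy)
  where open Factor F

Component-◂ : ∀ {m} s (shape : Fin m → Shape) → Component (s ◂ shape) ↔ (Vertex s ⊎ Component shape)
Component-◂ s shape = mk↔ₛ′ to [ (zero ,_) , (λ (j , x) → suc j , x) ] (λ { (inj₁ x) → refl ; (inj₂ y) → refl })
                                                                       (λ { (zero , x) → refl ; (suc j , y) → refl })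
  where
  to : Component (s ◂ shape) → Vertex s ⊎ Component shape
  to (zero  , x) = inj₁ x
  to (suc j , y) = inj₂ (j , y)

factor-add-edge : ∀ {n} (G : Graph (2 + n)) u v → adj G u (punchIn u v) ≡ true → Factor (G ∖ u ∖ v) → Factor G
factor-add-edge {n} G u v uv F = factor (p2 ◂ shape) e edges′
  where
  open Factor F
  -- The outer permutation sends 0, 1 and 2 + k to u, punchIn u v and punchIn u (punchIn v k).
  e : Component (p2 ◂ shape) ↔ Fin (2 + n)
  e = insert zero u (insert zero v (↔-id (Fin n)))
      ↔-∘ (↔-sym Finₚ.+↔⊎ ↔-∘ ((↔-id (Fin 2) ⊎-↔ placement F) ↔-∘ Component-◂ p2 shape))
  edges′ : ∀ j x y → SAdj ((p2 ◂ shape) j) x y → adj G (Inverse.to e (j , x)) (Inverse.to e (j , y)) ≡ true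
  edges′ zero  zero       (suc zero) _ = uv
  edges′ zero  (suc zero) zero       _ = trans (adj-sym G _ u) uv
  edges′ zero  zero       zero       (inj₁ ())
  edges′ zero  zero       zero       (inj₂ ())
  edges′ zero  (suc zero) (suc zero) (inj₁ ())
  edges′ zero  (suc zero) (suc zero) (inj₂ ())
  edges′ (suc j) x y xy = edges j x y xy

-- Graphs of order 4 and 5

data Small : Shape → Set where
  p2 : Small p2
  c3 : Small c3
  p5 : Small p5

pathAdj? : ∀ {k} (i j : Fin k) → Dec (PathAdj i j)
pathAdj? i j = (suc (toℕ i) ≟ toℕ j) ⊎-dec (suc (toℕ j) ≟ toℕ i)

sAdj? : ∀ {s} → Small s → (x y : Vertex s) → Dec (SAdj s x y)
sAdj? p2 = pathAdj?
sAdj? c3 x y = ¬? (x Finₚ.≟ y)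
sAdj? p5 = pathAdj?

all? : ∀ {s} → Small s → {P : Vertex s → Set} → (∀ x → Dec (P x)) → Dec (∀ x → P x)
all? p2 = Finₚ.all?
all? c3 = Finₚ.all?
all? p5 = Finₚ.all?

record Pattern (k : ℕ) : Set where
  field
    {m}   : ℕ
    shape : Fin m → Shape
    small : ∀ j → Small (shape j)
    place : Component shape ↔ Fin k
open Pattern

Placed : ∀ {k} → Graph k → Pattern k × Permutation′ k → Set
Placed G (P , π) = ∀ j x y → SAdj (shape P j) x y → adj G (e (j , x)) (e (j , y)) ≡ true
  where e = Inverse.to (π ↔-∘ place P)

placed? : ∀ {k} (G : Graph k) Pπ → Dec (Placed G Pπ)
placed? G (P , π) = Finₚ.all? λ j → all? (small P j) λ x → all? (small P j) λ y →
  sAdj? (small P j) x y →-dec adj G (e (j , x)) (e (j , y)) ≟ᵇ true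
  where e = Inverse.to (π ↔-∘ place P)

factor-of-placed : ∀ {k} {G : Graph k} {Pπ} → Placed G Pπ → Factor G
factor-of-placed {Pπ = P , π} = factor (shape P) (π ↔-∘ place P)

permutations : ∀ n → List (Permutation′ n)
permutations zero    = ↔-id (Fin 0) ∷ []
permutations (suc n) = concatMap (λ π → map (λ i → insert zero i π) (allFin (suc n))) (permutations n)

Placeable : ∀ {k} → Graph k → List (Pattern k) → Set
Placeable {k} G Ps = Any (Placed G) (cartesianProduct Ps (permutations k))

placeable? : ∀ {k} (G : Graph k) Ps → Dec (Placeable G Ps)
placeable? G Ps = any? (placed? G) _

factor-of-placeable : ∀ {k} {G : Graph k} {Ps} → Placeable G Ps → Factor G
factor-of-placeable placeable with satisfied placeable
... | Pπ , placed = factor-of-placed {Pπ = Pπ} placed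

single↔ : ∀ s → Component (λ (_ : Fin 1) → s) ↔ Vertex s
single↔ s = mk↔ₛ′ proj₂ (zero ,_) (λ _ → refl) λ { (zero , x) → refl }

pair↔ : ∀ s t → Component (s ◂ λ _ → t) ↔ (Vertex s ⊎ Vertex t)
pair↔ s t = (↔-id (Vertex s) ⊎-↔ single↔ t) ↔-∘ Component-◂ s _

matching4 : Pattern 4
matching4 = record { small = λ { zero → p2 ; (suc zero) → p2 } ; place = ↔-sym Finₚ.+↔⊎ ↔-∘ pair↔ p2 p2 }

triangle+edge : Pattern 5
triangle+edge = record { small = λ { zero → c3 ; (suc zero) → p2 } ; place = ↔-sym Finₚ.+↔⊎ ↔-∘ pair↔ c3 p2 }

path5 : Pattern 5
path5 = record { small = λ _ → p5 ; place = single↔ p5 }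

emptyGraph : Graph 0
emptyGraph = record { adj = λ () ; sym = λ () ; irrefl = λ () }

extend : ∀ {n} → Graph n → Vec Bool n → Graph (suc n)
extend {n} G row = record { adj = a ; sym = a-sym ; irrefl = a-irrefl }
  where
  a : Fin (suc n) → Fin (suc n) → Bool
  a zero    zero    = false
  a zero    (suc y) = lookup row y
  a (suc x) zero    = lookup row x
  a (suc x) (suc y) = adj G x y
  a-sym : ∀ x y → a x y ≡ a y x
  a-sym zero    zero    = refl
  a-sym zero    (suc y) = refl
  a-sym (suc x) zero    = refl
  a-sym (suc x) (suc y) = adj-sym G x y
  a-irrefl : ∀ x → a x x ≡ false
  a-irrefl zero    = refl
  a-irrefl (suc x) = irrefl G x

-- A copy of G built by extend, hence one of the graphs enumerated by allGraphs.
canonical : ∀ {n} → Graph n → Graph n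
canonical {zero}  G = emptyGraph
canonical {suc n} G = extend (canonical (G ∖ zero)) (Vec.tabulate (adj G zero ∘ suc))

canonical-≈ : ∀ {n} (G : Graph n) → canonical G ≈ G
canonical-≈ {suc n} G zero    zero    = sym (irrefl G zero)
canonical-≈ {suc n} G zero    (suc y) = lookup∘tabulate (adj G zero ∘ suc) y
canonical-≈ {suc n} G (suc x) zero    = trans (lookup∘tabulate (adj G zero ∘ suc) x) (adj-sym G zero (suc x))
canonical-≈ {suc n} G (suc x) (suc y) = canonical-≈ (G ∖ zero) x y

allRows : ∀ n → (Vec Bool n → Bool) → Bool
allRows zero    p = p Vec.[]
allRows (suc n) p = allRows n (p ∘ (true Vec.∷_)) ∧ allRows n (p ∘ (false Vec.∷_))

allRows-sound : ∀ {n} {p : Vec Bool n → Bool} → T (allRows n p) → ∀ row → T (p row)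
allRows-sound all-p Vec.[] = all-p
allRows-sound all-p (true  Vec.∷ row) = allRows-sound (proj₁ (Equivalence.to T-∧ all-p)) row
allRows-sound all-p (false Vec.∷ row) = allRows-sound (proj₂ (Equivalence.to T-∧ all-p)) row

allGraphs : ∀ n → (Graph n → Bool) → Bool
allGraphs zero    p = p emptyGraph
allGraphs (suc n) p = allGraphs n λ H → allRows n λ row → p (extend H row)

allGraphs-sound : ∀ {n} {p : Graph n → Bool} → T (allGraphs n p) → ∀ G → T (p (canonical G))
allGraphs-sound {zero}  all-p G = all-p
allGraphs-sound {suc n} all-p G = allRows-sound (allGraphs-sound all-p (G ∖ zero)) (Vec.tabulate (adj G zero ∘ suc))

minDegree≥1? : ∀ {n} (G : Graph n) → Dec (MinDegree≥1 G)
minDegree≥1? {n} G = Finₚ.all? {n} λ x → 1 ≤? deg G x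

admissible? : ∀ {n} b (G : Graph n) → Dec (Admissible b G)
admissible? b G = minDegree≥1? G ×-dec codegSum G ≤? b

factor-by-search : ∀ {k} b (Ps : List (Pattern k)) →
  T (allGraphs k λ G → isYes (admissible? b G →-dec placeable? G Ps)) →
  (G : Graph k) → Admissible b G → Factor G
factor-by-search b Ps verified G admissible = factor-cong {H = G′} G≈G′ (factor-of-placeable {Ps = Ps} placeable)
  where
  G′ = canonical G
  G≈G′ : G ≈ G′
  G≈G′ x y = sym (canonical-≈ G x y)
  placeable : Placeable G′ Ps
  placeable = toWitness {a? = admissible? b G′ →-dec placeable? G′ Ps} (allGraphs-sound verified G)
                        (admissible-cong {G = G} {G′} G≈G′ admissible)

factor-of-order4 : (G : Graph 4) → Admissible 8 G → Factor G
factor-of-order4 = factor-by-search 8 (matching4 ∷ []) _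

factor-of-order5 : (G : Graph 5) → Admissible 13 G → Factor G
factor-of-order5 = factor-by-search 13 (triangle+edge ∷ path5 ∷ []) _

-- The codegree bound

-- n² − 2 (F n + 1) for n ≥ 4 (codegBound+2[1+F]≡n*n), written so that it computes.
codegBound : ℕ → ℕ
codegBound 6 = 16
codegBound 8 = 26
codegBound (suc (suc (suc (suc k)))) = 8 + 5 * k
codegBound _ = 0

StepBound : ℕ → ℕ → ℕ → ℕ → Set
StepBound n p q S = 1 ≤ q → S ≤ (2 + n ∸ p) * q + p * p → p + p + (q + q) ≤ S + 2 →
                    S + 2 ∸ (p + p + (q + q)) ≤ codegBound n

StepBoundUpTo : ℕ → Set
StepBoundUpTo n = ∀ {p} → p < 3 + n → ∀ {q} → q < suc p → ∀ {S} → S < suc (codegBound (2 + n)) → StepBound n p q S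

stepBoundUpTo? : ∀ n → Dec (StepBoundUpTo n)
stepBoundUpTo? n = allUpTo? (λ p → allUpTo? (λ q → allUpTo? (λ S →
  1 ≤? q →-dec S ≤? (2 + n ∸ p) * q + p * p →-dec p + p + (q + q) ≤? S + 2 →-dec
  S + 2 ∸ (p + p + (q + q)) ≤? codegBound n) _) _) _

CodegBoundStep : ℕ → Set
CodegBoundStep n = ∀ {a p q S S′} → a + p ≡ 2 + n → 1 ≤ q → q ≤ p → S ≤ a * q + p * p → S ≤ codegBound (2 + n) →
                   S′ + (p + p + (q + q)) ≡ S + 2 → S′ ≤ codegBound n

codegBound-step-by-search : ∀ {n} → StepBoundUpTo n → CodegBoundStep n
codegBound-step-by-search {n} bound {a} {p} {q} {S} {S′} a+p≡2+n q≥1 q≤p S≤aq+pp S≤U S′+2p+2q≡S+2 =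
  subst (_≤ codegBound n) S′≡ (bound p<3+n (s≤s q≤p) (s≤s S≤U) q≥1 S≤ 2p+2q≤S+2)
  where
  p<3+n : p < 3 + n
  p<3+n = s≤s (subst (p ≤_) a+p≡2+n (m≤n+m p a))
  S≤ : S ≤ (2 + n ∸ p) * q + p * p
  S≤ = subst (λ a → S ≤ a * q + p * p) (trans (sym (m+n∸n≡m a p)) (cong (_∸ p) a+p≡2+n)) S≤aq+pp
  2p+2q≤S+2 : p + p + (q + q) ≤ S + 2
  2p+2q≤S+2 = subst (p + p + (q + q) ≤_) S′+2p+2q≡S+2 (m≤n+m _ S′)
  S′≡ : S + 2 ∸ (p + p + (q + q)) ≡ S′
  S′≡ = trans (cong (_∸ (p + p + (q + q))) (sym S′+2p+2q≡S+2)) (m+n∸n≡m S′ (p + p + (q + q)))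

codegBound-step-large : ∀ k → CodegBoundStep (9 + k)
codegBound-step-large k {a} {p} {q} {S} {S′} a+p≡2+n q≥1 q≤p S≤aq+pp S≤U S′+2p+2q≡S+2 with 6 ≤? p + q
... | yes p+q≥6 = +-cancelʳ-≤ 12 S′ (codegBound (9 + k)) (begin
  S′ + 12                  ≤⟨ +-monoʳ-≤ S′ (subst (12 ≤_) (double-sum p q) (+-mono-≤ p+q≥6 p+q≥6)) ⟩
  S′ + (p + p + (q + q))   ≡⟨ S′+2p+2q≡S+2 ⟩
  S + 2                    ≤⟨ +-monoˡ-≤ 2 S≤U ⟩
  8 + 5 * (7 + k) + 2      ≡⟨ lemma k ⟩
  codegBound (9 + k) + 12  ∎)
  where
  open ≤-Reasoning
  double-sum : ∀ p q → (p + q) + (p + q) ≡ p + p + (q + q)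
  double-sum = solve-∀
  lemma : ∀ k → 8 + 5 * (7 + k) + 2 ≡ 8 + 5 * (5 + k) + 12
  lemma = solve-∀
... | no p+q≱6 = +-cancelʳ-≤ (p + p) S′ (codegBound (9 + k)) (begin
  S′ + (p + p)                 ≤⟨ +-monoʳ-≤ S′ (m≤m+n (p + p) (q + q)) ⟩
  S′ + (p + p + (q + q))       ≡⟨ S′+2p+2q≡S+2 ⟩
  S + 2                        ≤⟨ +-monoˡ-≤ 2 S≤aq+pp ⟩
  a * q + p * p + 2            ≤⟨ +-monoˡ-≤ 2 (+-mono-≤ (*-monoʳ-≤ a q≤2) (*-monoʳ-≤ p p≤4)) ⟩
  a * 2 + p * 4 + 2            ≡⟨ regroup a p ⟩
  2 * (a + p) + 2 + (p + p)    ≡⟨ cong (λ m → 2 * m + 2 + (p + p)) a+p≡2+n ⟩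
  2 * (11 + k) + 2 + (p + p)   ≤⟨ +-monoˡ-≤ (p + p) (linear k) ⟩
  8 + 5 * (5 + k) + (p + p)    ∎)
  where
  open ≤-Reasoning
  p+q≤5 : p + q ≤ 5
  p+q≤5 = ≤-pred (≰⇒> p+q≱6)
  q≤2 : q ≤ 2
  q≤2 with q ≤? 2
  ... | yes q≤2 = q≤2
  ... | no  q≰2 = contradiction (≤-trans (+-mono-≤ (≰⇒> q≰2) (≰⇒> q≰2)) (≤-trans (+-monoˡ-≤ q q≤p) p+q≤5)) (<⇒≱ (n<1+n 5))
  p≤4 : p ≤ 4
  p≤4 = +-cancelʳ-≤ 1 p 4 (≤-trans (+-monoʳ-≤ p q≥1) p+q≤5)
  regroup : ∀ a p → a * 2 + p * 4 + 2 ≡ 2 * (a + p) + 2 + (p + p)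
  regroup = solve-∀
  linear : ∀ k → 2 * (11 + k) + 2 ≤ 8 + 5 * (5 + k)
  linear k = subst₂ _≤_ (sym (lhs k)) (sym (rhs k)) (+-mono-≤ (m≤m+n 24 9) (*-monoˡ-≤ k (m≤m+n 2 3)))
    where
    lhs : ∀ k → 2 * (11 + k) + 2 ≡ 24 + 2 * k
    lhs = solve-∀
    rhs : ∀ k → 8 + 5 * (5 + k) ≡ 33 + 5 * k
    rhs = solve-∀

codegBound-step : ∀ n → 4 ≤ n → CodegBoundStep n
codegBound-step 0 ()
codegBound-step 1 (s≤s ())
codegBound-step 2 (s≤s (s≤s ()))
codegBound-step 3 (s≤s (s≤s (s≤s ())))
codegBound-step 4 _ = codegBound-step-by-search (toWitness {a? = stepBoundUpTo? 4} _)
codegBound-step 5 _ = codegBound-step-by-search (toWitness {a? = stepBoundUpTo? 5} _)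
codegBound-step 6 _ = codegBound-step-by-search (toWitness {a? = stepBoundUpTo? 6} _)
codegBound-step 7 _ = codegBound-step-by-search (toWitness {a? = stepBoundUpTo? 7} _)
codegBound-step 8 _ = codegBound-step-by-search (toWitness {a? = stepBoundUpTo? 8} _)
codegBound-step (suc (suc (suc (suc (suc (suc (suc (suc (suc k))))))))) _ = codegBound-step-large k

codegBound[2+n]<5n : ∀ n → 4 ≤ n → codegBound (2 + n) < 5 * n
codegBound[2+n]<5n 0 ()
codegBound[2+n]<5n 1 (s≤s ())
codegBound[2+n]<5n 2 (s≤s (s≤s ()))
codegBound[2+n]<5n 3 (s≤s (s≤s (s≤s ())))
codegBound[2+n]<5n 4 _ = m<m+n 16 {4} (s≤s z≤n)
codegBound[2+n]<5n 5 _ = m<m+n 23 {2} (s≤s z≤n)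
codegBound[2+n]<5n 6 _ = m<m+n 26 {4} (s≤s z≤n)
codegBound[2+n]<5n (suc (suc (suc (suc (suc (suc (suc k))))))) _ =
  subst₂ _<_ (sym (lhs k)) (sym (rhs k)) (m<m+n (33 + 5 * k) {2} (s≤s z≤n))
  where
  lhs : ∀ k → 8 + 5 * (5 + k) ≡ 33 + 5 * k
  lhs = solve-∀
  rhs : ∀ k → 5 * (7 + k) ≡ 33 + 5 * k + 2
  rhs = solve-∀

no-isolated-vertex-after-step : ∀ n → 4 ≤ n → ∀ {p q S S′} → S′ + (p + p + (q + q)) ≡ S + 2 → S ≤ codegBound (2 + n) →
                                n + n + 4 ≤ p + p + (q + q) → 3 * n ≤ S′ + 2 → ⊥
no-isolated-vertex-after-step n 4≤n {p} {q} {S} {S′} S′+2p+2q≡S+2 S≤U 2n+4≤2p+2q 3n≤S′+2 =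
  <⇒≱ (+-monoˡ-< 4 (≤-<-trans S≤U (codegBound[2+n]<5n n 4≤n))) (begin
    5 * n + 4                     ≡⟨ split n ⟩
    3 * n + (n + n + 4)           ≤⟨ +-mono-≤ 3n≤S′+2 2n+4≤2p+2q ⟩
    S′ + 2 + (p + p + (q + q))    ≡⟨ swap S′ 2 (p + p + (q + q)) ⟩
    S′ + (p + p + (q + q)) + 2    ≡⟨ cong (_+ 2) S′+2p+2q≡S+2 ⟩
    S + 2 + 2                     ≡⟨ +-assoc S 2 2 ⟩
    S + 4                         ∎)
  where
  open ≤-Reasoning
  split : ∀ n → 5 * n + 4 ≡ 3 * n + (n + n + 4)
  split = solve-∀
  swap : ∀ a b c → a + b + c ≡ a + c + b
  swap = solve-∀

nC2+nC2+n≡n*n : ∀ n → n C 2 + n C 2 + n ≡ n * n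
nC2+nC2+n≡n*n zero    = refl
nC2+nC2+n≡n*n (suc n) = begin
  suc n C 2 + suc n C 2 + suc n            ≡⟨ cong (λ c → c + c + suc n) Pascal ⟨
  (n + n C 2) + (n + n C 2) + suc n        ≡⟨ regroup n (n C 2) ⟩
  (n C 2 + n C 2 + n) + (n + n + 1)        ≡⟨ cong (_+ (n + n + 1)) (nC2+nC2+n≡n*n n) ⟩
  n * n + (n + n + 1)                      ≡⟨ square n ⟩
  suc n * suc n                            ∎
  where
  open ≡-Reasoning
  Pascal : n + n C 2 ≡ suc n C 2
  Pascal = trans (cong (_+ n C 2) (sym (nC1≡n n))) (nCk+nC[k+1]≡[n+1]C[k+1] n 1)
  regroup : ∀ n c → (n + c) + (n + c) + suc n ≡ (c + c + n) + (n + n + 1)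
  regroup = solve-∀
  square : ∀ n → n * n + (n + n + 1) ≡ suc n * suc n
  square = solve-∀

codegBound+2[1+F]≡n*n : ∀ n → 4 ≤ n → codegBound n + (suc (F n) + suc (F n)) ≡ n * n
codegBound+2[1+F]≡n*n 0 ()
codegBound+2[1+F]≡n*n 1 (s≤s ())
codegBound+2[1+F]≡n*n 2 (s≤s (s≤s ()))
codegBound+2[1+F]≡n*n 3 (s≤s (s≤s (s≤s ())))
codegBound+2[1+F]≡n*n 4 _ = refl
codegBound+2[1+F]≡n*n 5 _ = refl
codegBound+2[1+F]≡n*n 6 _ = refl
codegBound+2[1+F]≡n*n 7 _ = refl
codegBound+2[1+F]≡n*n 8 _ = refl
codegBound+2[1+F]≡n*n (suc (suc (suc (suc (suc (suc (suc (suc (suc k))))))))) _ = +-cancelʳ-≡ (7 + k) _ _ (begin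
  8 + 5 * (5 + k) + (suc (c + 2) + suc (c + 2)) + (7 + k)  ≡⟨ regroup k c ⟨
  (39 + 5 * k) + (c + c + (7 + k))                         ≡⟨ cong ((39 + 5 * k) +_) (nC2+nC2+n≡n*n (7 + k)) ⟩
  (39 + 5 * k) + (7 + k) * (7 + k)                         ≡⟨ square k ⟨
  (9 + k) * (9 + k) + (7 + k)                              ∎)
  where
  open ≡-Reasoning
  c = (7 + k) C 2
  regroup : ∀ k c → (39 + 5 * k) + (c + c + (7 + k)) ≡ 8 + 5 * (5 + k) + (suc (c + 2) + suc (c + 2)) + (7 + k)
  regroup = solve-∀
  square : ∀ k → (9 + k) * (9 + k) + (7 + k) ≡ (39 + 5 * k) + (7 + k) * (7 + k)
  square = solve-∀

-- The induction

argmax : ∀ {n} (f : Fin (suc n) → ℕ) → Σ (Fin (suc n)) λ u → ∀ x → f x ≤ f u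
argmax {zero}  f = zero , λ { zero → ≤-refl }
argmax {suc n} f with argmax (f ∘ suc)
... | u , u-max with f (suc u) ≤? f zero
...   | yes fu≤f0 = zero  , λ { zero → ≤-refl ; (suc x) → ≤-trans (u-max x) fu≤f0 }
...   | no  fu≰f0 = suc u , λ { zero → <⇒≤ (≰⇒> fu≰f0) ; (suc x) → u-max x }

record ExtremalEdge {n} (G : Graph n) : Set where
  field
    u v   : Fin n
    u~v   : adj G u v ≡ true
    u-max : ∀ x → codeg G x ≤ codeg G u
    v-max : ∀ x → adj G u x ≡ true → codeg G x ≤ codeg G v

extremalEdge : ∀ {n} (G : Graph (suc n)) → MinDegree≥1 G → ExtremalEdge G
extremalEdge {n} G δ≥1 = record { u = u ; v = v ; u~v = u~v ; u-max = proj₂ (argmax (codeg G)) ; v-max = v-max }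
  where
  u = proj₁ (argmax (codeg G))
  neighbourCodeg : Fin (suc n) → ℕ
  neighbourCodeg x = if adj G u x then codeg G x else 0
  v = proj₁ (argmax neighbourCodeg)
  v-maxᵇ : ∀ x → neighbourCodeg x ≤ neighbourCodeg v
  v-maxᵇ = proj₂ (argmax neighbourCodeg)
  u~v : adj G u v ≡ true
  u~v with countTrue-witness (adj G u) (δ≥1 u)
  ... | w , u~w with adj G u v | v-maxᵇ w
  ...   | true  | _   = refl
  ...   | false | w≤0 = contradiction (≤-trans (codeg-pos G w) (subst (_≤ 0) (cong (λ b → if b then codeg G w else 0) u~w) w≤0)) λ ()
  v-max : ∀ x → adj G u x ≡ true → codeg G x ≤ codeg G v
  v-max x u~x = subst₂ _≤_ (cong (λ b → if b then codeg G x else 0) u~x) (cong (λ b → if b then codeg G v else 0) u~v)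
                           (v-maxᵇ x)

module RemoveExtremalEdge {n} (G : Graph (2 + n)) (E : ExtremalEdge G) where
  open ExtremalEdge E

  p q : ℕ
  p = codeg G u
  q = codeg G v

  u≢v : u ≢ v
  u≢v u≡v = contradiction (trans (sym (irrefl G u)) (trans (cong (adj G u) u≡v) u~v)) λ ()

  v′ : Fin (1 + n)
  v′ = punchOut u≢v

  punchIn-v′ : punchIn u v′ ≡ v
  punchIn-v′ = Finₚ.punchIn-punchOut u≢v

  H : Graph n
  H = G ∖ u ∖ v′

  q≡codeg-v′ : q ≡ codeg (G ∖ u) v′
  q≡codeg-v′ = begin
    codeg G v                                                       ≡⟨ cong (codeg G) punchIn-v′ ⟨
    codeg G (punchIn u v′)                                          ≡⟨ rowSum-∖ (bit ∘ not) G u v′ ⟩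
    bit (not (adj G u (punchIn u v′))) + codeg (G ∖ u) v′          ≡⟨ cong (λ x → bit (not (adj G u x)) + codeg (G ∖ u) v′) punchIn-v′ ⟩
    bit (not (adj G u v)) + codeg (G ∖ u) v′                        ≡⟨ cong (λ b → bit (not b) + codeg (G ∖ u) v′) u~v ⟩
    codeg (G ∖ u) v′                                                ∎
    where open ≡-Reasoning

  codegSum-H : codegSum H + (p + p + (q + q)) ≡ codegSum G + 2
  codegSum-H = begin
    codegSum H + (p + p + (q + q))       ≡⟨ regroup (codegSum H) p q ⟩
    p + p + (q + q + codegSum H)         ≡⟨ cong (λ c → p + p + (c + c + codegSum H)) q≡codeg-v′ ⟩
    p + p + (c + c + codegSum H)         ≡⟨ cong (p + p +_) (codegSum-∖ (G ∖ u) v′) ⟨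
    p + p + (codegSum (G ∖ u) + 1)       ≡⟨ +-assoc (p + p) _ 1 ⟨
    p + p + codegSum (G ∖ u) + 1         ≡⟨ cong (_+ 1) (codegSum-∖ G u) ⟨
    codegSum G + 1 + 1                   ≡⟨ +-assoc (codegSum G) 1 1 ⟩
    codegSum G + 2                       ∎
    where
    open ≡-Reasoning
    c = codeg (G ∖ u) v′
    regroup : ∀ s p q → s + (p + p + (q + q)) ≡ p + p + (q + q + s)
    regroup = solve-∀

  codegSum-G≤ : codegSum G ≤ deg G u * q + p * p
  codegSum-G≤ = begin
    codegSum G                                                   ≤⟨ sum-mono-≤ pointwise ⟩
    sum (λ x → bit (adj G u x) * q + bit (not (adj G u x)) * p)   ≡⟨ ∑-distrib-+ (λ x → bit (adj G u x) * q) (λ x → bit (not (adj G u x)) * p) ⟩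
    sum (λ x → bit (adj G u x) * q) + sum (λ x → bit (not (adj G u x)) * p)
      ≡⟨ cong₂ _+_ (sum-*ʳ (bit ∘ adj G u) q) (sum-*ʳ (bit ∘ not ∘ adj G u) p) ⟩
    deg G u * q + p * p                                          ∎
    where
    open ≤-Reasoning
    pointwise : ∀ x → codeg G x ≤ bit (adj G u x) * q + bit (not (adj G u x)) * p
    pointwise x with adj G u x in u~x
    ... | true  = ≤-trans (v-max x u~x) (≤-reflexive (sym (trans (+-identityʳ _) (+-identityʳ q))))
    ... | false = ≤-trans (u-max x) (≤-reflexive (sym (+-identityʳ p)))

  codegSum-H≤ : 4 ≤ n → codegSum G ≤ codegBound (2 + n) → codegSum H ≤ codegBound n
  codegSum-H≤ 4≤n σ≤U =
    codegBound-step n 4≤n {a = deg G u} (deg+codeg G u) (codeg-pos G v) (u-max v) codegSum-G≤ σ≤U codegSum-H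

  low-degree-bound : 4 ≤ n → ∀ y → deg G y ≤ bit (adj G u y) + 1 → n + n + 4 ≤ p + p + (q + q)
  low-degree-bound 4≤n y deg≤ with adj G u y in u~y
  ... | true  = ≤-trans (+-monoʳ-≤ (n + n) (+-mono-≤ 2≤n 2≤n)) (+-mono-≤ (+-mono-≤ n≤p n≤p) (+-mono-≤ n≤q n≤q))
    where
    2≤n : 2 ≤ n
    2≤n = ≤-trans (s≤s (s≤s z≤n)) 4≤n
    n≤q : n ≤ q
    n≤q = ≤-trans (+-cancelˡ-≤ 2 n (codeg G y) (order≤deg+codeg G y deg≤)) (v-max y u~y)
    n≤p : n ≤ p
    n≤p = ≤-trans n≤q (u-max v)
  ... | false = ≤-trans (≤-reflexive (regroup n)) (+-mono-≤ (+-mono-≤ n<p n<p) (+-mono-≤ (codeg-pos G v) (codeg-pos G v)))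
    where
    regroup : ∀ n → n + n + 4 ≡ suc n + suc n + (1 + 1)
    regroup = solve-∀
    n<p : n < p
    n<p = ≤-trans (+-cancelˡ-≤ 1 (suc n) (codeg G y) (order≤deg+codeg G y deg≤)) (u-max y)

  deg-of-isolated : ∀ x → deg H x ≡ 0 → let y = punchIn u (punchIn v′ x) in deg G y ≤ bit (adj G u y) + 1
  deg-of-isolated x deg≡0 = begin
    deg G y                                                     ≡⟨ rowSum-∖ bit G u (punchIn v′ x) ⟩
    bit (adj G u y) + deg (G ∖ u) (punchIn v′ x)                ≡⟨ cong (bit (adj G u y) +_) (rowSum-∖ bit (G ∖ u) v′ x) ⟩
    bit (adj G u y) + (bit (adj G (punchIn u v′) y) + deg H x)  ≡⟨ cong (λ d → bit (adj G u y) + (bit (adj G (punchIn u v′) y) + d)) deg≡0 ⟩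
    bit (adj G u y) + (bit (adj G (punchIn u v′) y) + 0)        ≤⟨ +-monoʳ-≤ (bit (adj G u y)) (+-monoˡ-≤ 0 (bit≤1 _)) ⟩
    bit (adj G u y) + 1                                         ∎
    where
    open ≤-Reasoning
    y = punchIn u (punchIn v′ x)

  admissible-H : 4 ≤ n → Admissible (codegBound (2 + n)) G → Admissible (codegBound n) H
  admissible-H 4≤n (_ , σ≤U) = δ≥1 , codegSum-H≤ 4≤n σ≤U
    where
    δ≥1 : MinDegree≥1 H
    δ≥1 x with deg H x in deg≡
    ... | zero  = ⊥-elim (no-isolated-vertex-after-step n 4≤n {p} {q} codegSum-H σ≤U
                           (low-degree-bound 4≤n _ (deg-of-isolated x deg≡)) (codegSum-isolated H x deg≡))
    ... | suc _ = s≤s z≤n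

  lift-factor : Factor H → Factor G
  lift-factor = factor-add-edge G u v′ (subst (λ z → adj G u z ≡ true) (sym punchIn-v′) u~v)

factor-of-admissible : ∀ n → 4 ≤ n → (G : Graph n) → Admissible (codegBound n) G → Factor G
factor-of-admissible 0 ()
factor-of-admissible 1 (s≤s ())
factor-of-admissible 2 (s≤s (s≤s ()))
factor-of-admissible 3 (s≤s (s≤s (s≤s ())))
factor-of-admissible 4 _ = factor-of-order4
factor-of-admissible 5 _ = factor-of-order5
factor-of-admissible (suc (suc n@(suc (suc (suc (suc _)))))) _ G admissible =
  lift-factor (factor-of-admissible n 4≤n H (admissible-H 4≤n admissible))
  where
  4≤n : 4 ≤ n
  4≤n = s≤s (s≤s (s≤s (s≤s z≤n)))
  open RemoveExtremalEdge G (extremalEdge G (proj₁ admissible))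

codegSum≤codegBound : ∀ {n} → 4 ≤ n → (G : Graph n) → F n < edgeCount G → codegSum G ≤ codegBound n
codegSum≤codegBound {n} 4≤n G F<e = +-cancelʳ-≤ (e + e) (codegSum G) (codegBound n) (begin
  codegSum G + (e + e)                     ≡⟨ cong (codegSum G +_) (handshake G) ⟩
  codegSum G + degSum G                    ≡⟨ codegSum+degSum G ⟩
  n * n                                    ≡⟨ codegBound+2[1+F]≡n*n n 4≤n ⟨
  codegBound n + (suc (F n) + suc (F n))   ≤⟨ +-monoʳ-≤ (codegBound n) (+-mono-≤ F<e F<e) ⟩
  codegBound n + (e + e)                   ∎)
  where
  open ≤-Reasoning
  e = edgeCount G

theorem1p1 : (n : ℕ) → 5 ≤ n → (G : Graph n) → Connected G → F n < edgeCount G → Factor G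
theorem1p1 n@(suc (suc _)) 5≤n G connected F<e =
  factor-of-admissible n 4≤n G (minDegree≥1-of-connected G connected , codegSum≤codegBound 4≤n G F<e)
  where
  4≤n : 4 ≤ n
  4≤n = ≤-trans (n≤1+n 4) 5≤n
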